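{- Let $f:\mathbb{Z}_{>0}\to\mathbb{C}$ be a multiplicative function such that $f(a^2+b^2+c^2)=f(a^2)+f(b^2)+f(c^2)$ for all positive integers $a,b,c$. Then $f(2^n)=2^n$, $f(3^n)=3^n$ and $f(5^n)=5^n$ for every positive integer $n$.
   Context: A function $f$ on the positive integers is multiplicative if $f(1)=1$ and $f(mn)=f(m)f(n)$ whenever $\gcd(m,n)=1$. -}

module Defs where

open import Level using (Level)
open import Algebra.Bundles using (CommutativeRing)
open import Data.Nat using (ℕ; zero; suc; _*_; _<_)
open import Data.Nat.Coprimality using (Coprime)
open import Data.Sum using (_⊎_)
open import Relation.Nullary using (¬_)

module _ {c ℓ : Level} (R : CommutativeRing c ℓ) where
  open CommutativeRing R renaming (Carrier to A; _*_ to _·_)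

  ι : ℕ → A
  ι zero    = 0#
  ι (suc n) = 1# + ι n

  record IsCharZeroDomain : Set (c Level.⊔ ℓ) where
    field
      nontrivial   : ¬ (1# ≈ 0#)
      noZeroDivisors : ∀ x y → x · y ≈ 0# → (x ≈ 0#) ⊎ (y ≈ 0#)
      charZero     : ∀ n → ¬ (ι (suc n) ≈ 0#)

  -- f : ℤ_{>0} → R, represented as ℕ → R; its value at 0 is never used.
  record Multiplicative (f : ℕ → A) : Set ℓ where
    field
      f1≈1 : f 1 ≈ 1#
      f-mul : ∀ m n → 0 < m → 0 < n → Coprime m n → f (m * n) ≈ f m · f n

module Submission where

-- Measure how far f is from the identity by its defect  δ m = f m - ι m ; the theorem
-- says δ (pⁿ) ≈ 0 for p = 2, 3, 5.  The hypothesis makes δ additive along every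
-- decomposition N = a² + b² + c² into positive squares (δ-squares), and multiplicativity
-- gives δ (P·M) ≈ ι P · δ M whenever δ P ≈ 0 and gcd (P, M) = 1 (δ-mul).  Since R is a
-- domain of characteristic zero, ι P · y ≈ 0 with P > 0 forces y ≈ 0.
-- Scaling the decompositions 3 = 1+1+1, 6 = 1+1+4, 9 = 1+4+4, 27 = 9+9+9 = 1+1+25 and
-- 30 = 1+4+25 by a square x = r² yields linear relations among δ x, δ (4x), δ (9x), ...
-- Together with δ 1 ≈ δ 3 ≈ δ 4 ≈ 0 (the last from 11 = 1+1+9, 33 = 3·11 = 4+4+25 and
-- 27 = 9+9+9 = 1+1+25) they carry δ ≈ 0 from x = (pᵏ)² to p²·x and to p·x, and even and
-- odd exponents together exhaust all powers pⁿ.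

open import Defs
open import Level using (Level)
open import Algebra.Bundles using (CommutativeRing)
open import Data.Nat using (ℕ; _<_; _^_)
import Data.Nat
import Data.Product

open import Data.Nat.Base as ℕ using (zero; suc; NonZero; >-nonZero⁻¹)
import Data.Nat.Properties as ℕₚ
open import Data.Nat.Divisibility using (∣-trans)
open import Data.Nat.Coprimality as Coprimality
  using (Coprime; coprime?; coprime-divisor; 1-coprimeTo)
open import Data.Nat.Tactic.RingSolver using (solve-∀)
open import Data.Product using (_,_; ∃)
open import Data.Sum using (_⊎_; inj₁; inj₂)
open import Data.Empty using (⊥-elim)
open import Relation.Binary.PropositionalEquality as ≡ using (_≡_; refl)
open import Relation.Nullary.Decidable using (True; toWitness)

coprime-* : ∀ {a b c} → Coprime a b → Coprime a c → Coprime a (b ℕ.* c)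
coprime-* {a} {b} a⊥b a⊥c {d} (d∣a , d∣bc) = a⊥c (d∣a , coprime-divisor d⊥b d∣bc)
  where
  d⊥b : Coprime d b
  d⊥b (e∣d , e∣b) = a⊥b (∣-trans e∣d d∣a , e∣b)

coprime-^ : ∀ {a b} → Coprime a b → ∀ k → Coprime a (b ^ k)
coprime-^ {a} a⊥b zero    = Coprimality.sym (1-coprimeTo a)
coprime-^     a⊥b (suc k) = coprime-* a⊥b (coprime-^ a⊥b k)

coprime-^² : ∀ {a p} → Coprime a p → ∀ k → Coprime a ((p ^ k) ^ 2)
coprime-^² a⊥p k = coprime-^ (coprime-^ a⊥p k) 2

coprime! : ∀ m n → {True (coprime? m n)} → Coprime m n
coprime! m n {m⊥n} = toWitness m⊥n

even-or-odd : ∀ n → ∃ λ k → n ≡ 2 ℕ.* k ⊎ n ≡ suc (2 ℕ.* k)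
even-or-odd zero = 0 , inj₁ refl
even-or-odd (suc n) with even-or-odd n
... | k , inj₁ n≡2k   = k , inj₂ (≡.cong suc n≡2k)
... | k , inj₂ n≡1+2k = suc k , inj₁ (≡.trans (≡.cong suc n≡1+2k) (≡.sym (ℕₚ.*-suc 2 k)))

square-power : ∀ p k → (p ^ k) ^ 2 ≡ p ^ (2 ℕ.* k)
square-power p k = ≡.trans (ℕₚ.^-*-assoc p k 2) (≡.cong (p ^_) (ℕₚ.*-comm k 2))

powers-by-parity : ∀ {ℓ} (P : ℕ → Set ℓ) p →
  (∀ k → P ((p ^ k) ^ 2)) → (∀ k → P (p ℕ.* (p ^ k) ^ 2)) → ∀ n → P (p ^ n)
powers-by-parity P p even odd n with even-or-odd n
... | k , inj₁ refl = ≡.subst P (square-power p k) (even k)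
... | k , inj₂ refl = ≡.subst P (≡.cong (p ℕ.*_) (square-power p k)) (odd k)

-- (a·r)² = a²·r², so multiplying a sum of three squares by r² gives one again.
-- The ring solver does not unfold _^_, hence the identity is handed to it unfolded.
square-* : ∀ a r → (a ℕ.* r) ^ 2 ≡ a ^ 2 ℕ.* r ^ 2
square-* = unfolded
  where
  unfolded : ∀ a r → (a ℕ.* r) ℕ.* ((a ℕ.* r) ℕ.* 1) ≡ (a ℕ.* (a ℕ.* 1)) ℕ.* (r ℕ.* (r ℕ.* 1))
  unfolded = solve-∀

scaled-squares : ∀ a b c r →
  (a ^ 2 ℕ.+ b ^ 2 ℕ.+ c ^ 2) ℕ.* r ^ 2 ≡ (a ℕ.* r) ^ 2 ℕ.+ (b ℕ.* r) ^ 2 ℕ.+ (c ℕ.* r) ^ 2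
scaled-squares a b c r = ≡.trans (distrib (a ^ 2) (b ^ 2) (c ^ 2) (r ^ 2))
  (≡.sym (≡.cong₂ ℕ._+_ (≡.cong₂ ℕ._+_ (square-* a r) (square-* b r)) (square-* c r)))
  where
  distrib : ∀ u v w x → (u ℕ.+ v ℕ.+ w) ℕ.* x ≡ u ℕ.* x ℕ.+ v ℕ.* x ℕ.+ w ℕ.* x
  distrib = solve-∀

module RingFacts {c ℓ : Level} (R : CommutativeRing c ℓ) where
  open CommutativeRing R renaming (_*_ to _·_; refl to ≈-refl)
  open import Relation.Binary.Reasoning.Setoid setoid
  open import Algebra.Properties.Semiring.Mult semiring
    using (_×_; ×-homo-+; ×1-homo-*; ×-assoc-*; ×-congʳ)
  open import Algebra.Properties.AbelianGroup +-abelianGroup using (⁻¹-∙-comm)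
  open import Algebra.Properties.CommutativeSemigroup +-commutativeSemigroup using (interchange)
  open import Algebra.Properties.Group +-group using (∙-cancelʳ)

  ι≈×1 : ∀ n → ι R n ≈ n × 1#
  ι≈×1 zero    = ≈-refl
  ι≈×1 (suc n) = +-congˡ (ι≈×1 n)

  ι-+ : ∀ m n → ι R (m ℕ.+ n) ≈ ι R m + ι R n
  ι-+ m n = begin
    ι R (m ℕ.+ n)     ≈⟨ ι≈×1 (m ℕ.+ n) ⟩
    (m ℕ.+ n) × 1#    ≈⟨ ×-homo-+ 1# m n ⟩
    m × 1# + n × 1#   ≈⟨ +-cong (ι≈×1 m) (ι≈×1 n) ⟨
    ι R m + ι R n     ∎

  ι-* : ∀ m n → ι R (m ℕ.* n) ≈ ι R m · ι R n
  ι-* m n = begin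
    ι R (m ℕ.* n)      ≈⟨ ι≈×1 (m ℕ.* n) ⟩
    (m ℕ.* n) × 1#     ≈⟨ ×1-homo-* m n ⟩
    (m × 1#) · (n × 1#) ≈⟨ *-cong (ι≈×1 m) (ι≈×1 n) ⟨
    ι R m · ι R n      ∎

  ι-· : ∀ n y → ι R n · y ≈ n × y
  ι-· n y = begin
    ι R n · y      ≈⟨ *-congʳ (ι≈×1 n) ⟩
    (n × 1#) · y   ≈⟨ ×-assoc-* n 1# y ⟩
    n × (1# · y)   ≈⟨ ×-congʳ n (*-identityˡ y) ⟩
    n × y          ∎

  ι2-· : ∀ y → ι R 2 · y ≈ y + y
  ι2-· y = trans (ι-· 2 y) (+-congˡ (+-identityʳ y))

  ι3-· : ∀ y → ι R 3 · y ≈ y + y + y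
  ι3-· y = trans (ι-· 3 y) (trans (+-congˡ (+-congˡ (+-identityʳ y))) (sym (+-assoc y y y)))

  -‿interchange : ∀ a b d e → (a + b) - (d + e) ≈ (a - d) + (b - e)
  -‿interchange a b d e = trans (+-congˡ (sym (⁻¹-∙-comm d e))) (interchange a b (- d) (- e))

  -‿interchange₃ : ∀ a b c d e g →
    (a + b + c) - (d + e + g) ≈ (a - d) + (b - e) + (c - g)
  -‿interchange₃ a b c d e g =
    trans (-‿interchange (a + b) c (d + e) g) (+-congʳ (-‿interchange a b d e))

  drop-zeros : ∀ {x y z} → x ≈ 0# → y ≈ 0# → x + y + z ≈ z
  drop-zeros {z = z} x≈0 y≈0 =
    trans (+-congʳ (trans (+-cong x≈0 y≈0) (+-identityʳ 0#))) (+-identityˡ z)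

  absorbed : ∀ {x y} → x + y ≈ y → x ≈ 0#
  absorbed {x} {y} x+y≈y = ∙-cancelʳ y x 0# (trans x+y≈y (sym (+-identityˡ y)))

  last-summand : ∀ {w x y z} → w ≈ x + y + z → w ≈ 0# → x ≈ 0# → y ≈ 0# → z ≈ 0#
  last-summand w≈ w≈0 x≈0 y≈0 = trans (sym (drop-zeros x≈0 y≈0)) (trans (sym w≈) w≈0)

module DomainFacts {c ℓ : Level} (R : CommutativeRing c ℓ) (domain : IsCharZeroDomain R) where
  open CommutativeRing R renaming (_*_ to _·_)
  open IsCharZeroDomain domain
  open import Relation.Binary.Reasoning.Setoid setoid
  open RingFacts R

  ι-cancel : ∀ k {y} → ι R (suc k) · y ≈ 0# → y ≈ 0#
  ι-cancel k ky≈0 with noZeroDivisors _ _ ky≈0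
  ... | inj₁ k≈0 = ⊥-elim (charZero k k≈0)
  ... | inj₂ y≈0 = y≈0

  double-zero : ∀ {y} → y + y ≈ 0# → y ≈ 0#
  double-zero {y} y+y≈0 = ι-cancel 1 (trans (ι2-· y) y+y≈0)

  repeated-summand : ∀ {w x y} → w ≈ x + y + y → w ≈ 0# → x ≈ 0# → y ≈ 0#
  repeated-summand {w} {x} {y} w≈ w≈0 x≈0 = double-zero (begin
    y + y         ≈⟨ +-identityˡ (y + y) ⟨
    0# + (y + y)  ≈⟨ +-congʳ x≈0 ⟨
    x + (y + y)   ≈⟨ +-assoc x y y ⟨
    x + y + y     ≈⟨ w≈ ⟨
    w             ≈⟨ w≈0 ⟩
    0#            ∎)

module Defect {c ℓ : Level} (R : CommutativeRing c ℓ) (domain : IsCharZeroDomain R)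
  (f : ℕ → CommutativeRing.Carrier R) (f-mult : Multiplicative R f)
  (f-squares : ∀ a b c → 0 < a → 0 < b → 0 < c →
    CommutativeRing._≈_ R (f (a ^ 2 Data.Nat.+ b ^ 2 Data.Nat.+ c ^ 2))
      (CommutativeRing._+_ R (CommutativeRing._+_ R (f (a ^ 2)) (f (b ^ 2))) (f (c ^ 2))))
  where
  open CommutativeRing R renaming (Carrier to A; _*_ to _·_; refl to ≈-refl)
  open import Relation.Binary.Reasoning.Setoid setoid
  open import Algebra.Properties.Group +-group using (x∙y⁻¹≈ε⇒x≈y; x≈y⇒x∙y⁻¹≈ε)
  open import Algebra.Properties.Ring ring using (x[y-z]≈xy-xz)
  open Multiplicative f-mult
  open RingFacts R
  open DomainFacts R domain

  δ : ℕ → A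
  δ m = f m - ι R m

  δ≈0⇒f≈ι : ∀ {m} → δ m ≈ 0# → f m ≈ ι R m
  δ≈0⇒f≈ι = x∙y⁻¹≈ε⇒x≈y _ _

  δ-cong : ∀ {m n} → m ≡ n → δ m ≈ δ n
  δ-cong refl = ≈-refl

  δ-1* : ∀ x → δ (1 ℕ.* x) ≈ δ x
  δ-1* x = δ-cong (ℕₚ.*-identityˡ x)

  δ1≈0 : δ 1 ≈ 0#
  δ1≈0 = x≈y⇒x∙y⁻¹≈ε (trans f1≈1 (sym (+-identityʳ 1#)))

  δ-squares : ∀ a b c .{{_ : NonZero a}} .{{_ : NonZero b}} .{{_ : NonZero c}} →
    δ (a ^ 2 ℕ.+ b ^ 2 ℕ.+ c ^ 2) ≈ δ (a ^ 2) + δ (b ^ 2) + δ (c ^ 2)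
  δ-squares a b c = begin
    f (X ℕ.+ Y ℕ.+ Z) - ι R (X ℕ.+ Y ℕ.+ Z)
      ≈⟨ +-cong (f-squares a b c (>-nonZero⁻¹ a) (>-nonZero⁻¹ b) (>-nonZero⁻¹ c))
                (-‿cong (trans (ι-+ (X ℕ.+ Y) Z) (+-congʳ (ι-+ X Y)))) ⟩
    (f X + f Y + f Z) - (ι R X + ι R Y + ι R Z)
      ≈⟨ -‿interchange₃ (f X) (f Y) (f Z) (ι R X) (ι R Y) (ι R Z) ⟩
    δ X + δ Y + δ Z ∎
    where
    X = a ^ 2
    Y = b ^ 2
    Z = c ^ 2

  δ-scaled : ∀ a b c r .{{_ : NonZero a}} .{{_ : NonZero b}} .{{_ : NonZero c}}
    .{{_ : NonZero r}} →
    δ ((a ^ 2 ℕ.+ b ^ 2 ℕ.+ c ^ 2) ℕ.* r ^ 2)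
      ≈ δ (a ^ 2 ℕ.* r ^ 2) + δ (b ^ 2 ℕ.* r ^ 2) + δ (c ^ 2 ℕ.* r ^ 2)
  δ-scaled a b c r = begin
    δ ((a ^ 2 ℕ.+ b ^ 2 ℕ.+ c ^ 2) ℕ.* r ^ 2)
      ≈⟨ δ-cong (scaled-squares a b c r) ⟩
    δ ((a ℕ.* r) ^ 2 ℕ.+ (b ℕ.* r) ^ 2 ℕ.+ (c ℕ.* r) ^ 2)
      ≈⟨ δ-squares (a ℕ.* r) (b ℕ.* r) (c ℕ.* r)
           {{ℕₚ.m*n≢0 a r}} {{ℕₚ.m*n≢0 b r}} {{ℕₚ.m*n≢0 c r}} ⟩
    δ ((a ℕ.* r) ^ 2) + δ ((b ℕ.* r) ^ 2) + δ ((c ℕ.* r) ^ 2)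
      ≈⟨ +-cong (+-cong (δ-cong (square-* a r)) (δ-cong (square-* b r)))
                (δ-cong (square-* c r)) ⟩
    δ (a ^ 2 ℕ.* r ^ 2) + δ (b ^ 2 ℕ.* r ^ 2) + δ (c ^ 2 ℕ.* r ^ 2) ∎

  δ-mul : ∀ P M .{{_ : NonZero P}} .{{_ : NonZero M}} → Coprime P M → δ P ≈ 0# →
    δ (P ℕ.* M) ≈ ι R P · δ M
  δ-mul P M P⊥M δP≈0 = begin
    f (P ℕ.* M) - ι R (P ℕ.* M)
      ≈⟨ +-cong (f-mul P M (>-nonZero⁻¹ P) (>-nonZero⁻¹ M) P⊥M) (-‿cong (ι-* P M)) ⟩
    f P · f M - ι R P · ι R M   ≈⟨ +-congʳ (*-congʳ (δ≈0⇒f≈ι δP≈0)) ⟩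
    ι R P · f M - ι R P · ι R M ≈⟨ x[y-z]≈xy-xz (ι R P) (f M) (ι R M) ⟨
    ι R P · δ M                 ∎

  exact-mul : ∀ P M .{{_ : NonZero P}} .{{_ : NonZero M}} → Coprime P M →
    δ P ≈ 0# → δ M ≈ 0# → δ (P ℕ.* M) ≈ 0#
  exact-mul P M P⊥M δP≈0 δM≈0 =
    trans (δ-mul P M P⊥M δP≈0) (trans (*-congˡ δM≈0) (zeroʳ (ι R P)))

  exact-div : ∀ k M .{{_ : NonZero M}} → Coprime (suc k) M →
    δ (suc k) ≈ 0# → δ (suc k ℕ.* M) ≈ 0# → δ M ≈ 0#
  exact-div k M P⊥M δP≈0 δPM≈0 = ι-cancel k (trans (sym (δ-mul (suc k) M P⊥M δP≈0)) δPM≈0)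

  δ3≈0 : δ 3 ≈ 0#
  δ3≈0 = trans (δ-squares 1 1 1) (trans (drop-zeros δ1≈0 δ1≈0) δ1≈0)

  δ4≈0 : δ 4 ≈ 0#
  δ4≈0 = double-zero (absorbed δ4+δ4+δ25≈δ25)
    where
    δ4+δ4+δ25≈δ25 : δ 4 + δ 4 + δ 25 ≈ δ 25
    δ4+δ4+δ25≈δ25 = begin
      δ 4 + δ 4 + δ 25  ≈⟨ δ-squares 2 2 5 ⟨
      δ 33              ≈⟨ δ-mul 3 11 (coprime! 3 11) δ3≈0 ⟩
      ι R 3 · δ 11      ≈⟨ *-congˡ (trans (δ-squares 1 1 3) (drop-zeros δ1≈0 δ1≈0)) ⟩
      ι R 3 · δ 9       ≈⟨ ι3-· (δ 9) ⟩
      δ 9 + δ 9 + δ 9   ≈⟨ δ-squares 3 3 3 ⟨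
      δ 27              ≈⟨ δ-squares 1 1 5 ⟩
      δ 1 + δ 1 + δ 25  ≈⟨ drop-zeros δ1≈0 δ1≈0 ⟩
      δ 25              ∎

  exact-at-powers : ∀ p →
    (∀ k → δ ((p ^ k) ^ 2) ≈ 0# → δ (p ^ 2 ℕ.* (p ^ k) ^ 2) ≈ 0#) →
    (∀ k → δ ((p ^ k) ^ 2) ≈ 0# → δ (p ℕ.* (p ^ k) ^ 2) ≈ 0#) →
    ∀ n → δ (p ^ n) ≈ 0#
  exact-at-powers p times-p² times-p =
    powers-by-parity (λ m → δ m ≈ 0#) p even (λ k → times-p k (even k))
    where
    even : ∀ k → δ ((p ^ k) ^ 2) ≈ 0#
    even zero    = δ1≈0
    even (suc k) = trans (δ-cong (square-* p (p ^ k))) (times-p² k (even k))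

  exact-3x : ∀ r .{{_ : NonZero r}} → δ (r ^ 2) ≈ 0# → δ (3 ℕ.* r ^ 2) ≈ 0#
  exact-3x r δx≈0 = trans (δ-scaled 1 1 1 r) (trans (drop-zeros δ1x≈0 δ1x≈0) δ1x≈0)
    where
    δ1x≈0 : δ (1 ℕ.* r ^ 2) ≈ 0#
    δ1x≈0 = trans (δ-1* (r ^ 2)) δx≈0

  -- 9x = x + 4x + 4x, where f is exact at 4x = 4 · x when x is odd.
  exact-9x : ∀ r .{{_ : NonZero r}} → Coprime 4 (r ^ 2) → δ (r ^ 2) ≈ 0# →
    δ (9 ℕ.* r ^ 2) ≈ 0#
  exact-9x r 4⊥x δx≈0 = trans (δ-scaled 1 2 2 r) (trans (drop-zeros δ1x≈0 δ4x≈0) δ4x≈0)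
    where
    instance
      x≢0 : NonZero (r ^ 2)
      x≢0 = ℕₚ.m^n≢0 r 2
    δ1x≈0 : δ (1 ℕ.* r ^ 2) ≈ 0#
    δ1x≈0 = trans (δ-1* (r ^ 2)) δx≈0
    δ4x≈0 : δ (4 ℕ.* r ^ 2) ≈ 0#
    δ4x≈0 = exact-mul 4 (r ^ 2) 4⊥x δ4≈0 δx≈0

  -- 9x = x + 4x + 4x read the other way: f is exact at 9x = 9 · x when 3 ∤ x.
  exact-4x : ∀ r .{{_ : NonZero r}} → Coprime 9 (r ^ 2) → δ 9 ≈ 0# → δ (r ^ 2) ≈ 0# →
    δ (4 ℕ.* r ^ 2) ≈ 0#
  exact-4x r 9⊥x δ9≈0 δx≈0 =
    repeated-summand (δ-scaled 1 2 2 r) (exact-mul 9 (r ^ 2) 9⊥x δ9≈0 δx≈0)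
      (trans (δ-1* (r ^ 2)) δx≈0)
    where
    instance
      x≢0 : NonZero (r ^ 2)
      x≢0 = ℕₚ.m^n≢0 r 2

  -- 6x = x + x + 4x, and f is exact at 3 and 6x = 3 · 2x when 3 ∤ 2x.
  exact-2x : ∀ r .{{_ : NonZero r}} → Coprime 3 (2 ℕ.* r ^ 2) →
    δ (r ^ 2) ≈ 0# → δ (4 ℕ.* r ^ 2) ≈ 0# → δ (2 ℕ.* r ^ 2) ≈ 0#
  exact-2x r 3⊥2x δx≈0 δ4x≈0 = exact-div 2 (2 ℕ.* r ^ 2) 3⊥2x δ3≈0 (begin
    δ (3 ℕ.* (2 ℕ.* r ^ 2))      ≈⟨ δ-cong (ℕₚ.*-assoc 3 2 (r ^ 2)) ⟨
    δ (6 ℕ.* r ^ 2)              ≈⟨ δ-scaled 1 1 2 r ⟩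
    δ (1 ℕ.* r ^ 2) + δ (1 ℕ.* r ^ 2) + δ (4 ℕ.* r ^ 2) ≈⟨ drop-zeros δ1x≈0 δ1x≈0 ⟩
    δ (4 ℕ.* r ^ 2)              ≈⟨ δ4x≈0 ⟩
    0#                           ∎)
    where
    instance
      x≢0 : NonZero (r ^ 2)
      x≢0 = ℕₚ.m^n≢0 r 2
      2x≢0 : NonZero (2 ℕ.* r ^ 2)
      2x≢0 = ℕₚ.m*n≢0 2 (r ^ 2)
    δ1x≈0 : δ (1 ℕ.* r ^ 2) ≈ 0#
    δ1x≈0 = trans (δ-1* (r ^ 2)) δx≈0

  -- 27x = 9x + 9x + 9x = x + x + 25x, where f is exact at 9x when 3 ∤ x.
  exact-25x : ∀ r .{{_ : NonZero r}} → Coprime 9 (r ^ 2) → δ 9 ≈ 0# → δ (r ^ 2) ≈ 0# →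
    δ (25 ℕ.* r ^ 2) ≈ 0#
  exact-25x r 9⊥x δ9≈0 δx≈0 = last-summand (δ-scaled 1 1 5 r) δ27x≈0 δ1x≈0 δ1x≈0
    where
    instance
      x≢0 : NonZero (r ^ 2)
      x≢0 = ℕₚ.m^n≢0 r 2
    δ1x≈0 : δ (1 ℕ.* r ^ 2) ≈ 0#
    δ1x≈0 = trans (δ-1* (r ^ 2)) δx≈0
    δ9x≈0 : δ (9 ℕ.* r ^ 2) ≈ 0#
    δ9x≈0 = exact-mul 9 (r ^ 2) 9⊥x δ9≈0 δx≈0
    δ27x≈0 : δ (27 ℕ.* r ^ 2) ≈ 0#
    δ27x≈0 = trans (δ-scaled 3 3 3 r) (trans (drop-zeros δ9x≈0 δ9x≈0) δ9x≈0)

  -- 30x = x + 4x + 25x, and f is exact at 6 and 30x = 6 · 5x when gcd(6, 5x) = 1.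
  exact-5x : ∀ r .{{_ : NonZero r}} → Coprime 4 (r ^ 2) → Coprime 6 (5 ℕ.* r ^ 2) →
    δ 6 ≈ 0# → δ (r ^ 2) ≈ 0# → δ (25 ℕ.* r ^ 2) ≈ 0# → δ (5 ℕ.* r ^ 2) ≈ 0#
  exact-5x r 4⊥x 6⊥5x δ6≈0 δx≈0 δ25x≈0 = exact-div 5 (5 ℕ.* r ^ 2) 6⊥5x δ6≈0 (begin
    δ (6 ℕ.* (5 ℕ.* r ^ 2))      ≈⟨ δ-cong (ℕₚ.*-assoc 6 5 (r ^ 2)) ⟨
    δ (30 ℕ.* r ^ 2)             ≈⟨ δ-scaled 1 2 5 r ⟩
    δ (1 ℕ.* r ^ 2) + δ (4 ℕ.* r ^ 2) + δ (25 ℕ.* r ^ 2)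
                                 ≈⟨ drop-zeros (trans (δ-1* (r ^ 2)) δx≈0) δ4x≈0 ⟩
    δ (25 ℕ.* r ^ 2)             ≈⟨ δ25x≈0 ⟩
    0#                           ∎)
    where
    instance
      x≢0 : NonZero (r ^ 2)
      x≢0 = ℕₚ.m^n≢0 r 2
      5x≢0 : NonZero (5 ℕ.* r ^ 2)
      5x≢0 = ℕₚ.m*n≢0 5 (r ^ 2)
    δ4x≈0 : δ (4 ℕ.* r ^ 2) ≈ 0#
    δ4x≈0 = exact-mul 4 (r ^ 2) 4⊥x δ4≈0 δx≈0

  exact-3^ : ∀ n → δ (3 ^ n) ≈ 0#
  exact-3^ = exact-at-powers 3 times-9 times-3
    where
    times-9 : ∀ k → δ ((3 ^ k) ^ 2) ≈ 0# → δ (9 ℕ.* (3 ^ k) ^ 2) ≈ 0#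
    times-9 k = exact-9x (3 ^ k) {{ℕₚ.m^n≢0 3 k}} (coprime-^² (coprime! 4 3) k)
    times-3 : ∀ k → δ ((3 ^ k) ^ 2) ≈ 0# → δ (3 ℕ.* (3 ^ k) ^ 2) ≈ 0#
    times-3 k = exact-3x (3 ^ k) {{ℕₚ.m^n≢0 3 k}}

  δ9≈0 : δ 9 ≈ 0#
  δ9≈0 = exact-3^ 2

  exact-2^ : ∀ n → δ (2 ^ n) ≈ 0#
  exact-2^ = exact-at-powers 2 times-4 times-2
    where
    times-4 : ∀ k → δ ((2 ^ k) ^ 2) ≈ 0# → δ (4 ℕ.* (2 ^ k) ^ 2) ≈ 0#
    times-4 k = exact-4x (2 ^ k) {{ℕₚ.m^n≢0 2 k}} (coprime-^² (coprime! 9 2) k) δ9≈0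
    times-2 : ∀ k → δ ((2 ^ k) ^ 2) ≈ 0# → δ (2 ℕ.* (2 ^ k) ^ 2) ≈ 0#
    times-2 k δx≈0 = exact-2x (2 ^ k) {{ℕₚ.m^n≢0 2 k}}
      (coprime-* (coprime! 3 2) (coprime-^² (coprime! 3 2) k)) δx≈0 (times-4 k δx≈0)

  δ6≈0 : δ 6 ≈ 0#
  δ6≈0 = exact-mul 3 2 (coprime! 3 2) δ3≈0 (exact-2^ 1)

  exact-5^ : ∀ n → δ (5 ^ n) ≈ 0#
  exact-5^ = exact-at-powers 5 times-25 times-5
    where
    times-25 : ∀ k → δ ((5 ^ k) ^ 2) ≈ 0# → δ (25 ℕ.* (5 ^ k) ^ 2) ≈ 0#
    times-25 k = exact-25x (5 ^ k) {{ℕₚ.m^n≢0 5 k}} (coprime-^² (coprime! 9 5) k) δ9≈0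
    times-5 : ∀ k → δ ((5 ^ k) ^ 2) ≈ 0# → δ (5 ℕ.* (5 ^ k) ^ 2) ≈ 0#
    times-5 k δx≈0 = exact-5x (5 ^ k) {{ℕₚ.m^n≢0 5 k}} (coprime-^² (coprime! 4 5) k)
      (coprime-* (coprime! 6 5) (coprime-^² (coprime! 6 5) k)) δ6≈0 δx≈0 (times-25 k δx≈0)

-- The theorem: f is exact at every power of 2, 3 and 5.
mainTheorem3 : {ℓ₁ ℓ₂ : Level} (R : CommutativeRing ℓ₁ ℓ₂) → IsCharZeroDomain R →
    (f : ℕ → CommutativeRing.Carrier R) → Multiplicative R f →
    (∀ a b c → 0 < a → 0 < b → 0 < c →
      CommutativeRing._≈_ R (f (a ^ 2 Data.Nat.+ b ^ 2 Data.Nat.+ c ^ 2))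
        (CommutativeRing._+_ R (CommutativeRing._+_ R (f (a ^ 2)) (f (b ^ 2))) (f (c ^ 2)))) →
    ∀ n → 0 < n →
      CommutativeRing._≈_ R (f (2 ^ n)) (ι R (2 ^ n))
      Data.Product.× CommutativeRing._≈_ R (f (3 ^ n)) (ι R (3 ^ n))
      Data.Product.× CommutativeRing._≈_ R (f (5 ^ n)) (ι R (5 ^ n))
mainTheorem3 R domain f f-mult f-squares n _ =
  δ≈0⇒f≈ι (exact-2^ n) , δ≈0⇒f≈ι (exact-3^ n) , δ≈0⇒f≈ι (exact-5^ n)
  where open Defect R domain f f-mult f-squares
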